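{- Let $a,b,c\ge 3$ be integers. Put $P=(a-2)(b-2)(c-2)$, let $\delta=0$ if $\gcd(a,b,c)$ is odd and $\delta=2$ if $\gcd(a,b,c)$ is even, and for $n\in\mathbb{N}$ set $l_n=2^{3-\delta}Pn$ and $$v_{a,b,c}=2^{ -\delta}\big((a-4)^2(b-2)(c-2)+(a-2)(b-4)^2(c-2)+(a-2)(b-2)(c-4)^2\big).$$ Let $V$ be the ternary quadratic space over $\mathbb{Q}$ with diagonal form $\langle a-2,b-2,c-2\rangle$ (up to the scalar factor $2^{2-\delta}P$, which does not affect isotropy). Then for every odd prime $p$ such that $V_p=V\otimes\mathbb{Q}_p$ is anisotropic, $l_n+v_{a,b,c}$ has bounded divisibility at $p$, i.e. there is a constant $C$ (depending on $a,b,c,p$) with $\operatorname{ord}_p(l_n+v_{a,b,c})\le C$ for all $n\in\mathbb{N}$.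
   Context: $\operatorname{ord}_p$ denotes the $p$-adic valuation; a quadratic space is isotropic if it has a nonzero vector $w$ with $Q(w)=0$, and anisotropic otherwise. $\mathbb{N}=\{0,1,2,\dots\}$. -}

module Defs where

open import Data.Nat.Base using (ℕ; zero; suc; _+_; _*_; _∸_; _^_; _≤_; _<_; ∣_-_∣; _%_; _/_; NonZero)
open import Data.Nat.Properties using (m^n≢0)
open import Data.Nat.Divisibility using (_∣_)
open import Data.Nat.GCD using (gcd)
open import Data.Bool.Base using (if_then_else_)
open import Data.Nat.Base using (_≡ᵇ_)
open import Data.Product using (Σ; _×_; ∃)
open import Data.Sum using (_⊎_)
open import Relation.Binary.PropositionalEquality using (_≡_; _≢_)
open import Relation.Nullary using (¬_)

δ : ℕ → ℕ → ℕ → ℕ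
δ a b c = if (gcd (gcd a b) c % 2 ≡ᵇ 0) then 2 else 0

-- P = (a-2)(b-2)(c-2)   (a,b,c ≥ 3, so truncated subtraction is exact)
Pabc : ℕ → ℕ → ℕ → ℕ
Pabc a b c = (a ∸ 2) * (b ∸ 2) * (c ∸ 2)

l : ℕ → ℕ → ℕ → ℕ → ℕ
l a b c n = 2 ^ (3 ∸ δ a b c) * Pabc a b c * n

-- numerator of v: (a-4)^2(b-2)(c-2) + (a-2)(b-4)^2(c-2) + (a-2)(b-2)(c-4)^2
-- (a-4)^2 is written ∣ a - 4 ∣ ^ 2, correct also for a = 3
vnum : ℕ → ℕ → ℕ → ℕ
vnum a b c = ∣ a - 4 ∣ ^ 2 * (b ∸ 2) * (c ∸ 2)
           + (a ∸ 2) * ∣ b - 4 ∣ ^ 2 * (c ∸ 2)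
           + (a ∸ 2) * (b ∸ 2) * ∣ c - 4 ∣ ^ 2

-- v_{a,b,c} = 2^(-δ) * vnum  (the division is exact)
v : ℕ → ℕ → ℕ → ℕ
v a b c = _/_ (vnum a b c) (2 ^ δ a b c) {{m^n≢0 2 (δ a b c)}}

-- p-adic integers ℤ_p as the inverse limit lim ℤ/p^k:
-- a compatible sequence of residues x k ∈ [0, p^k) with x (k+1) ≡ x k mod p^k.
record ℤ[_] (p : ℕ) : Set where
  field
    res    : ℕ → ℕ
    bound  : ∀ k → res k < p ^ k
    compat : ∀ k → ∃ λ q → res (suc k) ≡ res k + q * p ^ k
open ℤ[_] public

NonZeroₚ : ∀ {p} → ℤ[ p ] → Set
NonZeroₚ x = ∃ λ k → res x k ≢ 0

DiagZeroₚ : ∀ {p} → ℕ → ℕ → ℕ → ℤ[ p ] → ℤ[ p ] → ℤ[ p ] → Set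
DiagZeroₚ {p} α β γ x y z =
  ∀ k → p ^ k ∣ (α * res x k ^ 2 + β * res y k ^ 2 + γ * res z k ^ 2)

-- The ternary quadratic space ⟨α,β,γ⟩ over ℚ_p is isotropic:
-- a nonzero vector with Q(w) = 0.  (Clearing denominators, a nonzero
-- vector of ℚ_p^3 may be taken in ℤ_p^3.)
IsotropicQp : ℕ → ℕ → ℕ → ℕ → Set
IsotropicQp p α β γ =
  Σ ℤ[ p ] λ x → Σ ℤ[ p ] λ y → Σ ℤ[ p ] λ z →
    (NonZeroₚ x ⊎ NonZeroₚ y ⊎ NonZeroₚ z) × DiagZeroₚ α β γ x y z

AnisotropicQp : ℕ → ℕ → ℕ → ℕ → Set
AnisotropicQp p α β γ = ¬ IsotropicQp p α β γ

{-# OPTIONS --safe #-}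
-- Write A = a − 2, B = b − 2, C = c − 2 and e = ord_p(ABC). Since
--   2^δ (l_n + v) = 8ABC·n + vnum   and   vnum + 12ABC = ABC(A + B + C) + 4(AB + BC + CA)
-- and p is odd, p^e ∣ l_n + v forces p^e ∣ AB + BC + CA, and this makes ⟨A, B, C⟩ isotropic
-- over ℚ_p. Indeed, write A = p^α a′, B = p^β b′, C = p^γ c′ with p-units a′, b′, c′ and, by
-- symmetry, α ≥ β ≥ γ. If β < α then BC has strictly smaller valuation than AB and CA, which
-- is impossible. If α = β > γ then p ∣ a′ + b′, so (1, 1, 0) is a zero modulo p^(α+1). If
-- α = β = γ the conic a′ + b′x² + c′y² has a zero modulo p by pigeonhole. In the last two
-- cases the first coordinate is a unit, and Hensel's lemma lifts it to a zero over ℤ_p.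
-- Hence under anisotropy ord_p(l_n + v) < e for every n.
module Submission where

open import Defs
open import Data.Nat.Base
open import Data.Nat.Properties
open import Data.Nat.Divisibility
open import Data.Nat.DivMod
open import Data.Nat.Primality
open import Data.Nat.Coprimality using (Coprime; coprime-Bézout)
open import Data.Nat.GCD using (module Bézout; gcd; gcd[m,n]∣m; gcd[m,n]∣n)
open import Data.Nat.Induction using (<-rec)
open import Data.Nat.Tactic.RingSolver
open import Data.Bool.Base using (true; false; T; if_then_else_)
open import Data.Fin.Base using (Fin; toℕ; splitAt; join)
open import Data.Fin.Properties using (pigeonhole; toℕ-fromℕ<; toℕ-injective; toℕ<n; join-splitAt)
  renaming (<⇒≢ to <⇒≢ᶠ)
open import Data.Product using (∃; ∃₂; _×_; _,_; proj₁; proj₂)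
open import Data.Sum using (_⊎_; inj₁; inj₂; [_,_]′)
open import Data.Empty
open import Function using (_∘_)
open import Relation.Nullary
open import Relation.Nullary.Decidable using (decidable-stable)
open import Relation.Binary.Definitions using (tri<; tri≈; tri>)
open import Relation.Binary.PropositionalEquality

^-monoʳ-∣ : ∀ x {m n} → m ≤ n → x ^ m ∣ x ^ n
^-monoʳ-∣ x {m} m≤n with m≤n⇒∃[o]m+o≡n m≤n
... | k , refl = subst (x ^ m ∣_) (sym (^-distribˡ-+-* x m k)) (m∣m*n (x ^ k))

^-odd : ∀ {m} n → m % 2 ≡ 1 → m ^ n % 2 ≡ 1
^-odd zero    _   = refl
^-odd {m} (suc n) odd = begin
  m * m ^ n % 2               ≡⟨ %-distribˡ-* m (m ^ n) 2 ⟩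
  (m % 2) * (m ^ n % 2) % 2   ≡⟨ cong₂ (λ x y → x * y % 2) odd (^-odd n odd) ⟩
  1                           ∎
  where open ≡-Reasoning

∣m+n∣n⇒∣m : ∀ {d m n} → d ∣ m + n → d ∣ n → d ∣ m
∣m+n∣n⇒∣m {d} {m} {n} d∣m+n d∣n = ∣m+n∣m⇒∣n (subst (d ∣_) (+-comm m n) d∣m+n) d∣n

odd∣2*m⇒∣m : ∀ {d} m → d % 2 ≡ 1 → d ∣ 2 * m → d ∣ m
odd∣2*m⇒∣m {d} m odd d∣2m = ∣m+n∣m⇒∣n (subst (d ∣_) m*d≡ (n∣m*n m)) (∣n⇒∣m*n (d / 2) d∣2m)
  where
  open ≡-Reasoning
  m*d≡ : m * d ≡ d / 2 * (2 * m) + m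
  m*d≡ = begin
    m * d                    ≡⟨ cong (m *_) (m≡m%n+[m/n]*n d 2) ⟩
    m * (d % 2 + d / 2 * 2)  ≡⟨ cong (λ r → m * (r + d / 2 * 2)) odd ⟩
    m * (1 + d / 2 * 2)      ≡⟨ lemma m (d / 2) ⟩
    d / 2 * (2 * m) + m      ∎
    where
    lemma : ∀ m h → m * (1 + h * 2) ≡ h * (2 * m) + m
    lemma = solve-∀

[m+n]%d≡m%d⇒d∣n : ∀ {m n d} .{{_ : NonZero d}} → (m + n) % d ≡ m % d → d ∣ n
[m+n]%d≡m%d⇒d∣n {m} {n} {d} eq = divides (q′ ∸ q) (begin
  n                                   ≡⟨ m+n∸m≡n m n ⟨
  m + n ∸ m                           ≡⟨ cong₂ _∸_ (m≡m%n+[m/n]*n (m + n) d) (m≡m%n+[m/n]*n m d) ⟩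
  ((m + n) % d + q′ * d) ∸ (r + q * d) ≡⟨ cong (λ r′ → (r′ + q′ * d) ∸ (r + q * d)) eq ⟩
  (r + q′ * d) ∸ (r + q * d)          ≡⟨ [m+n]∸[m+o]≡n∸o r (q′ * d) (q * d) ⟩
  q′ * d ∸ q * d                      ≡⟨ *-distribʳ-∸ d q′ q ⟨
  (q′ ∸ q) * d                        ∎)
  where
  open ≡-Reasoning
  r = m % d
  q = m / d
  q′ = (m + n) / d

linear-congruence : ∀ {n c} .{{_ : NonZero n}} → Coprime n c → ∀ m → ∃ λ s → n ∣ m + c * s
linear-congruence {n} {c} coprime m with coprime-Bézout coprime
... | Bézout.+- x y 1+yc≡xn = m * y , divides (m * x) (begin
  m + c * (m * y)   ≡⟨ lemma m c y ⟩
  m * (1 + y * c)   ≡⟨ cong (m *_) 1+yc≡xn ⟩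
  m * (x * n)       ≡⟨ *-assoc m x n ⟨
  m * x * n         ∎)
  where
  open ≡-Reasoning
  lemma : ∀ m c y → m + c * (m * y) ≡ m * (1 + y * c)
  lemma = solve-∀
-- Here c y = 1 + x n, so c · y (n − 1) ≡ −1 (mod n).
... | Bézout.-+ x y 1+xn≡yc = m * y * pred n , divides (m * (1 + x * pred n)) (begin
  m + c * (m * y * pred n)              ≡⟨ lemma₁ m c y (pred n) ⟩
  m + m * pred n * (y * c)              ≡⟨ cong (λ t → m + m * pred n * t) 1+xn≡yc ⟨
  m + m * pred n * (1 + x * n)          ≡⟨ cong (λ k → m + m * pred n * (1 + x * k)) (suc-pred n) ⟨
  m + m * pred n * (1 + x * suc (pred n)) ≡⟨ lemma₂ m x (pred n) ⟩
  m * (1 + x * pred n) * suc (pred n)   ≡⟨ cong (m * (1 + x * pred n) *_) (suc-pred n) ⟩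
  m * (1 + x * pred n) * n              ∎)
  where
  open ≡-Reasoning
  lemma₁ : ∀ m c y k → m + c * (m * y * k) ≡ m + m * k * (y * c)
  lemma₁ = solve-∀
  lemma₂ : ∀ m x k → m + m * k * (1 + x * suc k) ≡ m * (1 + x * k) * suc k
  lemma₂ = solve-∀

reduce-square : ∀ u x d .{{_ : NonZero d}} → ∃ λ w → u * (x * x) ≡ u * (x % d * (x % d)) + w * d
reduce-square u x d = u * (x / d) * (2 * (x % d) + x / d * d) , (begin
  u * (x * x)                                         ≡⟨ cong (λ t → u * (t * t)) (m≡m%n+[m/n]*n x d) ⟩
  u * ((x % d + x / d * d) * (x % d + x / d * d))     ≡⟨ lemma u (x % d) (x / d) d ⟩
  u * (x % d * (x % d)) + u * (x / d) * (2 * (x % d) + x / d * d) * d ∎)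
  where
  open ≡-Reasoning
  lemma : ∀ u r q d → u * ((r + q * d) * (r + q * d)) ≡ u * (r * r) + u * q * (2 * r + q * d) * d
  lemma = solve-∀

diag-^2 : ∀ α x β y γ z → α * x ^ 2 + β * y ^ 2 + γ * z ^ 2 ≡ α * (x * x) + β * (y * y) + γ * (z * z)
diag-^2 α x β y γ z = cong₂ _+_ (cong₂ _+_ (square α x) (square β y)) (square γ z)
  where
  square : ∀ a t → a * t ^ 2 ≡ a * (t * t)
  square a t = cong (λ s → a * (t * s)) (*-identityʳ t)

∣-diag-% : ∀ {d} .{{_ : NonZero d}} α β γ x y z →
  d ∣ α * (x * x) + β * (y * y) + γ * (z * z) →
  d ∣ α * (x % d) ^ 2 + β * (y % d) ^ 2 + γ * (z % d) ^ 2
∣-diag-% {d} α β γ x y z d∣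
  with w₁ , eq₁ ← reduce-square α x d | w₂ , eq₂ ← reduce-square β y d | w₃ , eq₃ ← reduce-square γ z d
  = subst (d ∣_) (sym (diag-^2 α (x % d) β (y % d) γ (z % d)))
      (∣m+n∣n⇒∣m (subst (d ∣_) regroup d∣) (n∣m*n (w₁ + w₂ + w₃)))
  where
  regroup : α * (x * x) + β * (y * y) + γ * (z * z) ≡
            α * (x % d * (x % d)) + β * (y % d * (y % d)) + γ * (z % d * (z % d)) + (w₁ + w₂ + w₃) * d
  regroup = trans (cong₂ _+_ (cong₂ _+_ eq₁ eq₂) eq₃)
                  (lemma (α * (x % d * (x % d))) (β * (y % d * (y % d))) (γ * (z % d * (z % d))) w₁ w₂ w₃ d)
    where
    lemma : ∀ a b c w₁ w₂ w₃ d → a + w₁ * d + (b + w₂ * d) + (c + w₃ * d) ≡ a + b + c + (w₁ + w₂ + w₃) * d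
    lemma = solve-∀

module Residues (p : ℕ) .{{_ : NonZero p}} where

  module PowerModulus (k : ℕ) where
    instance
      p^k≢0 : NonZero (p ^ k)
      p^k≢0 = m^n≢0 p k

  residue : ℕ → ℕ → ℕ
  residue k x = x % p ^ k
    where open PowerModulus k

  Compatible : (ℕ → ℕ) → Set
  Compatible x = ∀ k → residue k (x (suc k)) ≡ residue k (x k)

  fromCompatible : (x : ℕ → ℕ) → Compatible x → ℤ[ p ]
  fromCompatible x compatible = record
    { res    = λ k → residue k (x k)
    ; bound  = residue<p^k
    ; compat = refines
    }
    where
    residue<p^k : ∀ k → residue k (x k) < p ^ k
    residue<p^k k = m%n<n (x k) (p ^ k)
      where open PowerModulus k
    refines : ∀ k → ∃ λ q → residue (suc k) (x (suc k)) ≡ residue k (x k) + q * p ^ k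
    refines k = r / p ^ k , (begin
      r                               ≡⟨ m≡m%n+[m/n]*n r (p ^ k) ⟩
      r % p ^ k + r / p ^ k * p ^ k   ≡⟨ cong (_+ r / p ^ k * p ^ k) r%p^k≡ ⟩
      x k % p ^ k + r / p ^ k * p ^ k ∎)
      where
      open ≡-Reasoning
      open PowerModulus k
      open PowerModulus (suc k) using () renaming (p^k≢0 to p^[1+k]≢0)
      r = x (suc k) % p ^ suc k
      r%p^k≡ : r % p ^ k ≡ x k % p ^ k
      r%p^k≡ = trans (m∣n⇒o%n%m≡o%m (p ^ k) (p ^ suc k) (x (suc k)) (n∣m*n p)) (compatible k)

  constant-compatible : ∀ y → Compatible (λ _ → y)
  constant-compatible y _ = refl

  fromℕₚ : ℕ → ℤ[ p ]
  fromℕₚ y = fromCompatible (λ _ → y) (constant-compatible y)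

  diagZero-fromCompatible : ∀ {α β γ x y z} (cx : Compatible x) (cy : Compatible y) (cz : Compatible z) →
    (∀ k → p ^ k ∣ α * (x k * x k) + β * (y k * y k) + γ * (z k * z k)) →
    DiagZeroₚ α β γ (fromCompatible x cx) (fromCompatible y cy) (fromCompatible z cz)
  diagZero-fromCompatible {α} {β} {γ} {x} {y} {z} _ _ _ zeros k =
    ∣-diag-% α β γ (x k) (y k) (z k) (zeros k)
    where open PowerModulus k

isotropic-rotate : ∀ {p} A B C → IsotropicQp p B C A → IsotropicQp p A B C
isotropic-rotate {p} A B C (x , y , z , nonzero , zeros) =
  z , x , y , rotate nonzero ,
  λ k → subst (p ^ k ∣_) (lemma (B * res x k ^ 2) (C * res y k ^ 2) (A * res z k ^ 2)) (zeros k)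
  where
  rotate : NonZeroₚ x ⊎ NonZeroₚ y ⊎ NonZeroₚ z → NonZeroₚ z ⊎ NonZeroₚ x ⊎ NonZeroₚ y
  rotate (inj₁ x≢0)        = inj₂ (inj₁ x≢0)
  rotate (inj₂ (inj₁ y≢0)) = inj₂ (inj₂ y≢0)
  rotate (inj₂ (inj₂ z≢0)) = inj₁ z≢0
  lemma : ∀ a b c → a + b + c ≡ c + a + b
  lemma = solve-∀

isotropic-swap : ∀ {p} A B C → IsotropicQp p A C B → IsotropicQp p A B C
isotropic-swap {p} A B C (x , y , z , nonzero , zeros) =
  x , z , y , swap nonzero ,
  λ k → subst (p ^ k ∣_) (lemma (A * res x k ^ 2) (C * res y k ^ 2) (B * res z k ^ 2)) (zeros k)
  where
  swap : NonZeroₚ x ⊎ NonZeroₚ y ⊎ NonZeroₚ z → NonZeroₚ x ⊎ NonZeroₚ z ⊎ NonZeroₚ y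
  swap (inj₁ x≢0)        = inj₁ x≢0
  swap (inj₂ (inj₁ y≢0)) = inj₂ (inj₂ y≢0)
  swap (inj₂ (inj₂ z≢0)) = inj₂ (inj₁ z≢0)
  lemma : ∀ a b c → a + b + c ≡ a + c + b
  lemma = solve-∀

e₂ : ℕ → ℕ → ℕ → ℕ
e₂ A B C = A * B + B * C + C * A

∣e₂-∣AB⇒∣BC+CA : ∀ {d} A B C → d ∣ e₂ A B C → d ∣ A * B → d ∣ B * C + C * A
∣e₂-∣AB⇒∣BC+CA {d} A B C d∣e₂ = ∣m+n∣m⇒∣n (subst (d ∣_) (+-assoc (A * B) (B * C) (C * A)) d∣e₂)

max-of-three : ∀ α β γ → (β ≤ α × γ ≤ α) ⊎ (γ ≤ β × α ≤ β) ⊎ (α ≤ γ × β ≤ γ)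
max-of-three α β γ with ≤-total β α | ≤-total γ α | ≤-total γ β
... | inj₁ β≤α | inj₁ γ≤α | _        = inj₁ (β≤α , γ≤α)
... | inj₁ β≤α | inj₂ α≤γ | _        = inj₂ (inj₂ (α≤γ , ≤-trans β≤α α≤γ))
... | inj₂ α≤β | _        | inj₁ γ≤β = inj₂ (inj₁ (γ≤β , α≤β))
... | inj₂ α≤β | _        | inj₂ β≤γ = inj₂ (inj₂ (≤-trans α≤β β≤γ , β≤γ))

record Valuation (p n : ℕ) : Set where
  constructor mkValuation
  field
    ord          : ℕ
    unit         : ℕ
    n≡p^ord*unit : n ≡ p ^ ord * unit
    p∤unit       : p ∤ unit

open Valuation

e₂-rotate-∣ : ∀ {p A B C} (vA : Valuation p A) (vB : Valuation p B) (vC : Valuation p C) →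
  p ^ (ord vA + ord vB + ord vC) ∣ e₂ A B C → p ^ (ord vB + ord vC + ord vA) ∣ e₂ B C A
e₂-rotate-∣ {p} {A} {B} {C} vA vB vC = subst₂ _∣_ (cong (p ^_) (lemma₁ (ord vA) (ord vB) (ord vC))) (lemma₂ A B C)
  where
  lemma₁ : ∀ α β γ → α + β + γ ≡ β + γ + α
  lemma₁ = solve-∀
  lemma₂ : ∀ A B C → A * B + B * C + C * A ≡ B * C + C * A + A * B
  lemma₂ = solve-∀

e₂-swap-∣ : ∀ {p A B C} (vA : Valuation p A) (vB : Valuation p B) (vC : Valuation p C) →
  p ^ (ord vA + ord vB + ord vC) ∣ e₂ A B C → p ^ (ord vA + ord vC + ord vB) ∣ e₂ A C B
e₂-swap-∣ {p} {A} {B} {C} vA vB vC = subst₂ _∣_ (cong (p ^_) (lemma₁ (ord vA) (ord vB) (ord vC))) (lemma₂ A B C)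
  where
  lemma₁ : ∀ α β γ → α + β + γ ≡ α + γ + β
  lemma₁ = solve-∀
  lemma₂ : ∀ A B C → A * B + B * C + C * A ≡ A * C + C * B + B * A
  lemma₂ = solve-∀

module _ {p : ℕ} (p-prime : Prime p) where

  private instance
    p≢0 : NonZero p
    p≢0 = prime⇒nonZero p-prime

  p∤1 : p ∤ 1
  p∤1 = >⇒∤ (nonTrivial⇒n>1 p {{prime⇒nonTrivial p-prime}})

  ∤-* : ∀ {m n} → p ∤ m → p ∤ n → p ∤ m * n
  ∤-* {m} {n} p∤m p∤n p∣mn = [ p∤m , p∤n ]′ (euclidsLemma m n p-prime p∣mn)

  ∤⇒coprime : ∀ {n} → p ∤ n → Coprime p n
  ∤⇒coprime p∤n (d∣p , d∣n) with prime⇒irreducible p-prime d∣p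
  ... | inj₁ d≡1    = d≡1
  ... | inj₂ refl   = ⊥-elim (p∤n d∣n)

  valuation : ∀ n → .{{NonZero n}} → Valuation p n
  valuation = <-rec (λ n → .{{NonZero n}} → Valuation p n) step
    where
    instance _ = prime⇒nonTrivial p-prime
    step : ∀ n → (∀ {m} → m < n → .{{NonZero m}} → Valuation p m) → .{{NonZero n}} → Valuation p n
    step n rec with p ∣? n
    ... | no p∤n  = mkValuation 0 n (sym (*-identityˡ n)) p∤n
    ... | yes p∣n =
      let mkValuation o u q≡p^o*u p∤u = rec (quotient-< p∣n) {{quotient≢0 p∣n}}
      in  mkValuation (suc o) u (trans (m∣n⇒n≡quotient*m p∣n)
                                  (trans (cong (_* p) q≡p^o*u) (lemma (p ^ o) u p))) p∤u
      where
      lemma : ∀ x u p → x * u * p ≡ p * x * u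
      lemma = solve-∀

  valuation-* : ∀ {m n} → Valuation p m → Valuation p n → Valuation p (m * n)
  valuation-* {m} {n} vm vn = record
    { ord          = ord vm + ord vn
    ; unit         = unit vm * unit vn
    ; n≡p^ord*unit = begin
        m * n                                   ≡⟨ cong₂ _*_ (n≡p^ord*unit vm) (n≡p^ord*unit vn) ⟩
        p ^ ord vm * a * (p ^ ord vn * b)       ≡⟨ lemma (p ^ ord vm) a (p ^ ord vn) b ⟩
        p ^ ord vm * p ^ ord vn * (a * b)       ≡⟨ cong (_* (a * b)) (^-distribˡ-+-* p (ord vm) (ord vn)) ⟨
        p ^ (ord vm + ord vn) * (a * b)         ∎
    ; p∤unit       = ∤-* (p∤unit vm) (p∤unit vn)
    }
    where
    open ≡-Reasoning
    a = unit vm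
    b = unit vn
    lemma : ∀ x a y b → x * a * (y * b) ≡ x * y * (a * b)
    lemma = solve-∀

  p^ord∣ : ∀ {n} (v : Valuation p n) → p ^ ord v ∣ n
  p^ord∣ v = subst (p ^ ord v ∣_) (sym (n≡p^ord*unit v)) (m∣m*n (unit v))

  p^≤ord∣ : ∀ {n m} (v : Valuation p n) → m ≤ ord v → p ^ m ∣ n
  p^≤ord∣ v m≤ord = ∣-trans (^-monoʳ-∣ p m≤ord) (p^ord∣ v)

  p^[1+ord]∤ : ∀ {n} (v : Valuation p n) → p ^ suc (ord v) ∤ n
  p^[1+ord]∤ (mkValuation o u refl p∤u) p^[1+o]∣ =
    p∤u (*-cancelˡ-∣ (p ^ o) {{m^n≢0 p o}} (subst (_∣ p ^ o * u) (*-comm p (p ^ o)) p^[1+o]∣))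

  p^ord∤e₂ : ∀ {A B C} (vA : Valuation p A) (vB : Valuation p B) (vC : Valuation p C) →
    ord vC ≤ ord vB → ord vB < ord vA → p ^ (ord vA + ord vB + ord vC) ∤ e₂ A B C
  p^ord∤e₂ {A} {B} {C} vA vB vC γ≤β β<α p^[α+β+γ]∣ =
    p^[1+ord]∤ (valuation-* vB vC)
      (∣m+n∣n⇒∣m (∣e₂-∣AB⇒∣BC+CA A B C (∣-trans (^-monoʳ-∣ p 1+β+γ≤α+β+γ) p^[α+β+γ]∣)
                                       (p^≤ord∣ (valuation-* vA vB) 1+β+γ≤α+β))
                 (p^≤ord∣ (valuation-* vC vA) 1+β+γ≤γ+α))
    where
    α = ord vA
    β = ord vB
    γ = ord vC
    1+β+γ≤α+β+γ : suc (β + γ) ≤ α + β + γ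
    1+β+γ≤α+β+γ = ≤-trans (+-monoˡ-≤ γ β<α) (+-monoˡ-≤ γ (m≤m+n α β))
    1+β+γ≤α+β : suc (β + γ) ≤ α + β
    1+β+γ≤α+β = +-mono-≤ β<α γ≤β
    1+β+γ≤γ+α : suc (β + γ) ≤ γ + α
    1+β+γ≤γ+α = ≤-trans (+-monoˡ-≤ γ β<α) (≤-reflexive (+-comm α γ))

  p∣unit+unit : ∀ {A B C} (vA : Valuation p A) (vB : Valuation p B) (vC : Valuation p C) →
    ord vB ≡ ord vA → ord vC < ord vA → p ^ (ord vA + ord vB + ord vC) ∣ e₂ A B C → p ∣ unit vA + unit vB
  p∣unit+unit {A} {B} {C} vA@(mkValuation α a A≡ _) vB@(mkValuation _ b B≡ _) vC refl γ<α p^[α+α+γ]∣ =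
    decidable-stable (p ∣? a + b) λ p∤a+b →
      p^[1+ord]∤ (valuation-* vC (mkValuation α (a + b) A+B≡ p∤a+b))
        (subst (p ^ suc (γ + α) ∣_) (lemma A B C)
          (∣e₂-∣AB⇒∣BC+CA A B C (∣-trans (^-monoʳ-∣ p (≤-trans 1+γ+α≤α+α (m≤m+n (α + α) γ))) p^[α+α+γ]∣)
                                (p^≤ord∣ (valuation-* vA vB) 1+γ+α≤α+α)))
    where
    γ = ord vC
    1+γ+α≤α+α : suc (γ + α) ≤ α + α
    1+γ+α≤α+α = +-monoˡ-≤ α γ<α
    A+B≡ : A + B ≡ p ^ α * (a + b)
    A+B≡ = trans (cong₂ _+_ A≡ B≡) (sym (*-distribˡ-+ (p ^ α) a b))
    lemma : ∀ A B C → B * C + C * A ≡ C * (A + B)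
    lemma = solve-∀

  module Hensel (p∤2 : p ∤ 2) {u D x₀ : ℕ} (p∤u : p ∤ u) (p∤x₀ : p ∤ x₀) (p∣ : p ∣ u * (x₀ * x₀) + D) where

    record ApproxRoot (k : ℕ) : Set where
      field
        root   : ℕ
        p∤root : p ∤ root
        approx : p ^ suc k ∣ u * (root * root) + D

    open ApproxRoot public

    newton-correction : ∀ {k} (r : ApproxRoot k) → ∃ λ s → p ∣ quotient (approx r) + 2 * u * root r * s
    newton-correction r = linear-congruence (∤⇒coprime (∤-* (∤-* p∤2 p∤u) (p∤root r))) (quotient (approx r))

    -- Newton's step: if u t² + D = m p^(k+1) and p ∣ m + 2uts, then t + s p^(k+1) is a root modulo p^(k+2).
    lift : ∀ {k} → ApproxRoot k → ApproxRoot (suc k)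
    lift {k} r = record
      { root   = t + s * q
      ; p∤root = λ p∣t+sq → p∤root r (∣m+n∣n⇒∣m p∣t+sq (∣n⇒∣m*n s (m∣m*n (p ^ k))))
      ; approx = subst (p * q ∣_) (sym expansion) (∣m∣n⇒∣m+n p*q∣linear p*q∣quadratic)
      }
      where
      open ≡-Reasoning
      t = root r
      s = proj₁ (newton-correction r)
      q = p ^ suc k
      m = quotient (approx r)
      c = 2 * u * t
      m*q≡ : m * q ≡ u * (t * t) + D
      m*q≡ = sym (_∣_.equality (approx r))
      p*q∣linear : p * q ∣ q * (m + c * s)
      p*q∣linear = subst (_∣ q * (m + c * s)) (*-comm q p) (*-monoʳ-∣ q (proj₂ (newton-correction r)))
      p*q∣quadratic : p * q ∣ q * q * (u * (s * s))
      p*q∣quadratic = ∣m⇒∣m*n (u * (s * s)) (*-monoˡ-∣ q (m∣m*n {p} (p ^ k)))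
      expansion : u * ((t + s * q) * (t + s * q)) + D ≡ q * (m + c * s) + q * q * (u * (s * s))
      expansion = begin
        u * ((t + s * q) * (t + s * q)) + D                      ≡⟨ lemma₁ u t s q D ⟩
        (u * (t * t) + D) + q * (c * s) + q * q * (u * (s * s))  ≡⟨ cong (λ e → e + q * (c * s) + q * q * (u * (s * s))) m*q≡ ⟨
        m * q + q * (c * s) + q * q * (u * (s * s))              ≡⟨ lemma₂ m q (c * s) (u * (s * s)) ⟩
        q * (m + c * s) + q * q * (u * (s * s))                  ∎
        where
        lemma₁ : ∀ u t s q D → u * ((t + s * q) * (t + s * q)) + D ≡
                               (u * (t * t) + D) + q * (2 * u * t * s) + q * q * (u * (s * s))
        lemma₁ = solve-∀
        lemma₂ : ∀ m q x y → m * q + q * x + q * q * y ≡ q * (m + x) + q * q * y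
        lemma₂ = solve-∀

    approximation : ∀ k → ApproxRoot k
    approximation zero    = record
      { root = x₀ ; p∤root = p∤x₀ ; approx = subst (_∣ u * (x₀ * x₀) + D) (sym (*-identityʳ p)) p∣ }
    approximation (suc k) = lift (approximation k)

    roots : ℕ → ℕ
    roots k = root (approximation k)

    roots-compatible : Residues.Compatible p roots
    roots-compatible k = trans (cong (λ e → (roots k + e) % p ^ k) (sym (*-assoc s p (p ^ k))))
                               ([m+kn]%n≡m%n (roots k) (s * p) (p ^ k))
      where
      open Residues.PowerModulus p k
      s = proj₁ (newton-correction (approximation k))

  module _ (odd : p % 2 ≡ 1) where

    p∤2 : p ∤ 2
    p∤2 p∣2 = contradiction (trans (cong (_% 2) (≤-antisym p>1 (∣⇒≤ p∣2))) odd) λ ()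
      where p>1 = nonTrivial⇒n>1 p {{prime⇒nonTrivial p-prime}}

    isotropic-by-lifting : ∀ {u D} α B C x₀ y₀ z₀ → p ∤ u → p ∤ x₀ →
      B * (y₀ * y₀) + C * (z₀ * z₀) ≡ p ^ α * D → p ∣ u * (x₀ * x₀) + D →
      IsotropicQp p (p ^ α * u) B C
    isotropic-by-lifting {u} {D} α B C x₀ y₀ z₀ p∤u p∤x₀ BC≡p^αD p∣ =
      fromCompatible roots roots-compatible , fromℕₚ y₀ , fromℕₚ z₀ ,
      inj₁ (1 , root₁≢0) ,
      diagZero-fromCompatible {p ^ α * u} {B} {C}
        roots-compatible (constant-compatible y₀) (constant-compatible z₀) zeros
      where
      open Residues p
      open Hensel p∤2 p∤u p∤x₀ p∣
      root₁≢0 : residue 1 (roots 1) ≢ 0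
      root₁≢0 root₁%p≡0 = p∤root (approximation 1) (m*n∣⇒m∣ p 1 (m%n≡0⇒n∣m (roots 1) (p ^ 1) root₁%p≡0))
        where open PowerModulus 1
      zeros : ∀ k → p ^ k ∣ p ^ α * u * (roots k * roots k) + B * (y₀ * y₀) + C * (z₀ * z₀)
      zeros k = subst (p ^ k ∣_) (regroup (roots k))
                  (∣n⇒∣m*n (p ^ α) (∣-trans (^-monoʳ-∣ p (n≤1+n k)) (approx (approximation k))))
        where
        open ≡-Reasoning
        regroup : ∀ t → p ^ α * (u * (t * t) + D) ≡ p ^ α * u * (t * t) + B * (y₀ * y₀) + C * (z₀ * z₀)
        regroup t = begin
          p ^ α * (u * (t * t) + D)              ≡⟨ *-distribˡ-+ (p ^ α) (u * (t * t)) D ⟩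
          p ^ α * (u * (t * t)) + p ^ α * D      ≡⟨ cong₂ _+_ (*-assoc (p ^ α) u (t * t)) BC≡p^αD ⟨
          p ^ α * u * (t * t) + (By₀² + Cz₀²)    ≡⟨ +-assoc (p ^ α * u * (t * t)) By₀² Cz₀² ⟨
          p ^ α * u * (t * t) + By₀² + Cz₀²      ∎
          where
          By₀² = B * (y₀ * y₀)
          Cz₀² = C * (z₀ * z₀)

    private
      h : ℕ
      h = p / 2

    p≡1+h+h : p ≡ suc (h + h)
    p≡1+h+h = trans (m≡m%n+[m/n]*n p 2) (cong₂ _+_ odd (lemma h))
      where
      lemma : ∀ h → h * 2 ≡ h + h
      lemma = solve-∀

    squares-distinct : ∀ {K E x x'} → p ∤ K → x < x' → x' ≤ h →
      (E + K * (x * x)) % p ≢ (E + K * (x' * x')) % p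
    squares-distinct {K} {E} {x} p∤K x<x' x'≤h with m≤n⇒∃[o]m+o≡n x<x'
    ... | d , refl = λ eq → ∤-* p∤K (∤-* p∤1+d p∤x'+x)
                               ([m+n]%d≡m%d⇒d∣n (trans (cong (_% p) (sym (lemma E K x d))) (sym eq)))
      where
      -- (x + 1 + d)² − x² = (1 + d)(x + 1 + d + x), and both factors lie strictly between 0 and p.
      lemma : ∀ E K x d → E + K * (suc (x + d) * suc (x + d)) ≡
                          E + K * (x * x) + K * (suc d * (suc (x + d) + x))
      lemma = solve-∀
      h<p : h + h < p
      h<p = subst (h + h <_) (sym p≡1+h+h) (n<1+n (h + h))
      p∤1+d : p ∤ suc d
      p∤1+d = >⇒∤ (≤-<-trans (≤-trans (s≤s (m≤n+m d x)) x'≤h) (≤-<-trans (m≤m+n h h) h<p))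
      p∤x'+x : p ∤ suc (x + d) + x
      p∤x'+x = >⇒∤ (≤-<-trans (+-mono-≤ x'≤h (≤-trans (<⇒≤ x<x') x'≤h)) h<p)

    square-residues-injective : ∀ {K E x x'} → p ∤ K → x ≤ h → x' ≤ h →
      (E + K * (x * x)) % p ≡ (E + K * (x' * x')) % p → x ≡ x'
    square-residues-injective {x = x} {x'} p∤K x≤h x'≤h eq with <-cmp x x'
    ... | tri< x<x' _ _ = ⊥-elim (squares-distinct p∤K x<x' x'≤h eq)
    ... | tri≈ _ x≡x' _ = x≡x'
    ... | tri> _ _ x'<x = ⊥-elim (squares-distinct p∤K x'<x x≤h (sym eq))

    conic-solvable : ∀ {a b} → p ∤ a → p ∤ b → ∀ c → ∃₂ λ x y → p ∣ a * (x * x) + b * (y * y) + c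
    conic-solvable {a} {b} p∤a p∤b c = from-collision (pigeonhole p<1+h+1+h (value ∘ splitAt (suc h)))
      where
      open ≡-Reasoning
      -- The h + 1 residues of c + a x² and the h + 1 residues of −b y² ≡ (p − 1) b y² (x, y ≤ h) cannot all differ.
      value : Fin (suc h) ⊎ Fin (suc h) → Fin p
      value (inj₁ x) = (c + a * (toℕ x * toℕ x)) mod p
      value (inj₂ y) = (pred p * b * (toℕ y * toℕ y)) mod p
      p<1+h+1+h : p < suc h + suc h
      p<1+h+1+h = subst₂ _<_ (sym p≡1+h+h) (sym (cong suc (+-suc h h))) (n<1+n (suc (h + h)))
      splitAt-injective : ∀ {i j} → splitAt (suc h) i ≡ splitAt (suc h) j → i ≡ j
      splitAt-injective {i} {j} s≡s' = begin
        i                                          ≡⟨ join-splitAt (suc h) (suc h) i ⟨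
        join (suc h) (suc h) (splitAt (suc h) i)   ≡⟨ cong (join (suc h) (suc h)) s≡s' ⟩
        join (suc h) (suc h) (splitAt (suc h) j)   ≡⟨ join-splitAt (suc h) (suc h) j ⟩
        j                                          ∎
      mod-≡ : ∀ {m n} → m mod p ≡ n mod p → m % p ≡ n % p
      mod-≡ eq = trans (sym (toℕ-fromℕ< _)) (trans (cong toℕ eq) (toℕ-fromℕ< _))
      ≤h : (i : Fin (suc h)) → toℕ i ≤ h
      ≤h i = s≤s⁻¹ (toℕ<n i)
      p∤-1 : p ∤ pred p
      p∤-1 p∣pred = p∤1 (∣m+n∣n⇒∣m (subst (p ∣_) (sym (suc-pred p)) ∣-refl) p∣pred)
      solution : ∀ x y → (c + a * (x * x)) % p ≡ (pred p * b * (y * y)) % p →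
                 p ∣ a * (x * x) + b * (y * y) + c
      solution x y eq = subst (p ∣_) (lemma₁ a x b y c) (m%n≡0⇒n∣m _ p (begin
        (c + a * (x * x) + Z) % p                  ≡⟨ %-distribˡ-+ (c + a * (x * x)) Z p ⟩
        ((c + a * (x * x)) % p + Z % p) % p        ≡⟨ cong (λ r → (r + Z % p) % p) eq ⟩
        ((pred p * b * (y * y)) % p + Z % p) % p   ≡⟨ %-distribˡ-+ (pred p * b * (y * y)) Z p ⟨
        (pred p * b * (y * y) + Z) % p             ≡⟨ cong (_% p) (lemma₂ (pred p) b (y * y)) ⟩
        (Z * suc (pred p)) % p                     ≡⟨ cong (λ e → (Z * e) % p) (suc-pred p) ⟩
        (Z * p) % p                                ≡⟨ m*n%n≡0 Z p ⟩
        0                                          ∎))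
        where
        Z = b * (y * y)
        lemma₁ : ∀ a x b y c → c + a * (x * x) + b * (y * y) ≡ a * (x * x) + b * (y * y) + c
        lemma₁ = solve-∀
        lemma₂ : ∀ k b w → k * b * w + b * w ≡ b * w * suc k
        lemma₂ = solve-∀
      collide : ∀ s s' → s ≢ s' → value s ≡ value s' → ∃₂ λ x y → p ∣ a * (x * x) + b * (y * y) + c
      collide (inj₁ x) (inj₁ x') s≢s' eq = ⊥-elim (s≢s' (cong inj₁ (toℕ-injective
        (square-residues-injective p∤a (≤h x) (≤h x') (mod-≡ eq)))))
      collide (inj₂ y) (inj₂ y') s≢s' eq = ⊥-elim (s≢s' (cong inj₂ (toℕ-injective
        (square-residues-injective {E = 0} (∤-* p∤-1 p∤b) (≤h y) (≤h y') (mod-≡ eq)))))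
      collide (inj₁ x) (inj₂ y) _ eq = toℕ x , toℕ y , solution (toℕ x) (toℕ y) (mod-≡ eq)
      collide (inj₂ y) (inj₁ x) _ eq = toℕ x , toℕ y , solution (toℕ x) (toℕ y) (sym (mod-≡ eq))
      from-collision : (∃₂ λ i j → toℕ i < toℕ j × value (splitAt (suc h) i) ≡ value (splitAt (suc h) j)) →
                       ∃₂ λ x y → p ∣ a * (x * x) + b * (y * y) + c
      from-collision (i , j , i<j , eq) =
        collide (splitAt (suc h) i) (splitAt (suc h) j) (<⇒≢ᶠ i<j ∘ splitAt-injective) eq

    isotropic-sorted : ∀ {A B C} (vA : Valuation p A) (vB : Valuation p B) (vC : Valuation p C) →
      ord vC ≤ ord vB → ord vB ≤ ord vA → p ^ (ord vA + ord vB + ord vC) ∣ e₂ A B C → IsotropicQp p A B C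
    isotropic-sorted vA@(mkValuation α a refl p∤a) vB@(mkValuation β b refl p∤b) vC@(mkValuation γ c refl p∤c)
                     γ≤β β≤α p^[α+β+γ]∣ with m≤n⇒m<n∨m≡n β≤α | m≤n⇒m<n∨m≡n γ≤β
    ... | inj₁ β<α  | _         = ⊥-elim (p^ord∤e₂ vA vB vC γ≤β β<α p^[α+β+γ]∣)
    ... | inj₂ refl | inj₁ γ<α  =
      isotropic-by-lifting α (p ^ α * b) (p ^ γ * c) 1 1 0 p∤a p∤1 (lemma (p ^ α) b (p ^ γ * c))
        (subst (p ∣_) (cong (_+ b) (sym (*-identityʳ a))) (p∣unit+unit vA vB vC refl γ<α p^[α+β+γ]∣))
      where
      lemma : ∀ x b z → x * b * (1 * 1) + z * (0 * 0) ≡ x * b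
      lemma = solve-∀
    ... | inj₂ refl | inj₂ refl with conic-solvable p∤b p∤c a
    ...   | x , y , p∣ =
      isotropic-by-lifting α (p ^ α * b) (p ^ α * c) 1 x y p∤a p∤1 (lemma₁ (p ^ α) b c x y)
        (subst (p ∣_) (lemma₂ a b c x y) p∣)
      where
      lemma₁ : ∀ q b c x y → q * b * (x * x) + q * c * (y * y) ≡ q * (b * (x * x) + c * (y * y))
      lemma₁ = solve-∀
      lemma₂ : ∀ a b c x y → b * (x * x) + c * (y * y) + a ≡ a * (1 * 1) + (b * (x * x) + c * (y * y))
      lemma₂ = solve-∀

    isotropic-if-max : ∀ {A B C} (vA : Valuation p A) (vB : Valuation p B) (vC : Valuation p C) →
      ord vB ≤ ord vA → ord vC ≤ ord vA → p ^ (ord vA + ord vB + ord vC) ∣ e₂ A B C → IsotropicQp p A B C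
    isotropic-if-max {A} {B} {C} vA vB vC β≤α γ≤α p^[α+β+γ]∣ with ≤-total (ord vC) (ord vB)
    ... | inj₁ γ≤β = isotropic-sorted vA vB vC γ≤β β≤α p^[α+β+γ]∣
    ... | inj₂ β≤γ = isotropic-swap A B C (isotropic-sorted vA vC vB β≤γ γ≤α (e₂-swap-∣ vA vB vC p^[α+β+γ]∣))

    isotropic-if-e₂-divisible : ∀ {A B C} (vA : Valuation p A) (vB : Valuation p B) (vC : Valuation p C) →
      p ^ (ord vA + ord vB + ord vC) ∣ e₂ A B C → IsotropicQp p A B C
    isotropic-if-e₂-divisible {A} {B} {C} vA vB vC p^[α+β+γ]∣ with max-of-three (ord vA) (ord vB) (ord vC)
    ... | inj₁ (β≤α , γ≤α)        = isotropic-if-max vA vB vC β≤α γ≤α p^[α+β+γ]∣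
    ... | inj₂ (inj₁ (γ≤β , α≤β)) =
      isotropic-rotate A B C (isotropic-if-max vB vC vA γ≤β α≤β (e₂-rotate-∣ vA vB vC p^[α+β+γ]∣))
    ... | inj₂ (inj₂ (α≤γ , β≤γ)) =
      isotropic-rotate A B C (isotropic-rotate B C A
        (isotropic-if-max vC vA vB α≤γ β≤γ (e₂-rotate-∣ vB vC vA (e₂-rotate-∣ vA vB vC p^[α+β+γ]∣))))

δ-cases : ∀ a b c → δ a b c ≡ 0 ⊎ (δ a b c ≡ 2 × 2 ∣ gcd (gcd a b) c)
δ-cases a b c = if-cases (gcd (gcd a b) c % 2 ≡ᵇ 0) (λ t → m%n≡0⇒n∣m _ 2 (≡ᵇ⇒≡ _ 0 t))
  where
  if-cases : ∀ {g} bool → (T bool → 2 ∣ g) →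
             (if bool then 2 else 0) ≡ 0 ⊎ ((if bool then 2 else 0) ≡ 2 × 2 ∣ g)
  if-cases true  2∣g = inj₂ (refl , 2∣g _)
  if-cases false _   = inj₁ refl

2∣⇒2∣∸2 : ∀ {n} → 2 ∣ n → 2 ∣ n ∸ 2
2∣⇒2∣∸2 {0}           2∣n = 2∣n
2∣⇒2∣∸2 {1}           2∣1 = contradiction (∣1⇒≡1 2∣1) λ ()
2∣⇒2∣∸2 {suc (suc n)} 2∣n = ∣m+n∣m⇒∣n 2∣n ∣-refl

2^δ∣vnum : ∀ a b c → 2 ^ δ a b c ∣ vnum a b c
2^δ∣vnum a b c with δ-cases a b c
... | inj₁ δ≡0       = subst (λ e → 2 ^ e ∣ vnum a b c) (sym δ≡0) (1∣ vnum a b c)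
... | inj₂ (δ≡2 , 2∣g) = subst (λ e → 2 ^ e ∣ vnum a b c) (sym δ≡2)
  (∣m∣n⇒∣m+n (∣m∣n⇒∣m+n (*-pres-∣ (∣n⇒∣m*n (∣ a - 4 ∣ ^ 2) 2∣B) 2∣C)
                        (*-pres-∣ (∣m⇒∣m*n (∣ b - 4 ∣ ^ 2) 2∣A) 2∣C))
             (∣m⇒∣m*n (∣ c - 4 ∣ ^ 2) (*-pres-∣ 2∣A 2∣B)))
  where
  2∣A : 2 ∣ a ∸ 2
  2∣A = 2∣⇒2∣∸2 (∣-trans 2∣g (∣-trans (gcd[m,n]∣m (gcd a b) c) (gcd[m,n]∣m a b)))
  2∣B : 2 ∣ b ∸ 2
  2∣B = 2∣⇒2∣∸2 (∣-trans 2∣g (∣-trans (gcd[m,n]∣m (gcd a b) c) (gcd[m,n]∣n a b)))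
  2∣C : 2 ∣ c ∸ 2
  2∣C = 2∣⇒2∣∸2 (∣-trans 2∣g (gcd[m,n]∣n (gcd a b) c))

2^δ*[l+v]≡8Pn+vnum : ∀ a b c n → 2 ^ δ a b c * (l a b c n + v a b c) ≡ 8 * Pabc a b c * n + vnum a b c
2^δ*[l+v]≡8Pn+vnum a b c n = begin
  2 ^ d * (l a b c n + v a b c)                   ≡⟨ *-distribˡ-+ (2 ^ d) (l a b c n) (v a b c) ⟩
  2 ^ d * (2 ^ (3 ∸ d) * P * n) + 2 ^ d * v a b c ≡⟨ cong₂ _+_ 2^d*l≡ (m*[n/m]≡n {{m^n≢0 2 d}} (2^δ∣vnum a b c)) ⟩
  8 * P * n + vnum a b c                          ∎
  where
  open ≡-Reasoning
  d = δ a b c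
  P = Pabc a b c
  d≤3 : d ≤ 3
  d≤3 = [ (λ d≡0 → subst (_≤ 3) (sym d≡0) z≤n) , (λ (d≡2 , _) → subst (_≤ 3) (sym d≡2) (s≤s (s≤s z≤n))) ]′
          (δ-cases a b c)
  2^d*l≡ : 2 ^ d * (2 ^ (3 ∸ d) * P * n) ≡ 8 * P * n
  2^d*l≡ = begin
    2 ^ d * (2 ^ (3 ∸ d) * P * n)  ≡⟨ lemma (2 ^ d) (2 ^ (3 ∸ d)) P n ⟩
    2 ^ d * 2 ^ (3 ∸ d) * P * n    ≡⟨ cong (λ e → e * P * n) (^-distribˡ-+-* 2 d (3 ∸ d)) ⟨
    2 ^ (d + (3 ∸ d)) * P * n      ≡⟨ cong (λ e → 2 ^ e * P * n) (m+[n∸m]≡n d≤3) ⟩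
    8 * P * n                      ∎
    where
    lemma : ∀ x y P n → x * (y * P * n) ≡ x * y * P * n
    lemma = solve-∀

∣n-2∣²+4n≡n²+4 : ∀ n → ∣ n - 2 ∣ ^ 2 + 4 * n ≡ n * n + 4
∣n-2∣²+4n≡n²+4 0             = refl
∣n-2∣²+4n≡n²+4 1             = refl
∣n-2∣²+4n≡n²+4 (suc (suc m)) = begin
  ∣ m - 0 ∣ ^ 2 + 4 * suc (suc m)           ≡⟨ cong (λ e → e ^ 2 + 4 * suc (suc m)) (∣-∣-identityʳ m) ⟩
  m * (m * 1) + 4 * suc (suc m)             ≡⟨ cong (λ e → m * e + 4 * suc (suc m)) (*-identityʳ m) ⟩
  m * m + 4 * suc (suc m)                   ≡⟨ lemma m ⟩
  suc (suc m) * suc (suc m) + 4             ∎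
  where
  open ≡-Reasoning
  lemma : ∀ m → m * m + 4 * suc (suc m) ≡ suc (suc m) * suc (suc m) + 4
  lemma = solve-∀

vnum-identity : ∀ A B C → vnum (2 + A) (2 + B) (2 + C) + 12 * (A * B * C) ≡ A * B * C * (A + B + C) + 4 * e₂ A B C
vnum-identity A B C = begin
  X * B * C + A * Y * C + A * B * Z + 12 * (A * B * C)               ≡⟨ lemma₁ A B C X Y Z ⟩
  (X + 4 * A) * B * C + A * (Y + 4 * B) * C + A * B * (Z + 4 * C)   ≡⟨ cong₂ _+_ (cong₂ _+_
      (cong (λ e → e * B * C) (∣n-2∣²+4n≡n²+4 A)) (cong (λ e → A * e * C) (∣n-2∣²+4n≡n²+4 B)))
      (cong (λ e → A * B * e) (∣n-2∣²+4n≡n²+4 C)) ⟩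
  (A * A + 4) * B * C + A * (B * B + 4) * C + A * B * (C * C + 4)   ≡⟨ lemma₂ A B C ⟩
  A * B * C * (A + B + C) + 4 * e₂ A B C                            ∎
  where
  open ≡-Reasoning
  X = ∣ A - 2 ∣ ^ 2
  Y = ∣ B - 2 ∣ ^ 2
  Z = ∣ C - 2 ∣ ^ 2
  lemma₁ : ∀ A B C X Y Z → X * B * C + A * Y * C + A * B * Z + 12 * (A * B * C) ≡
                           (X + 4 * A) * B * C + A * (Y + 4 * B) * C + A * B * (Z + 4 * C)
  lemma₁ = solve-∀
  lemma₂ : ∀ A B C → (A * A + 4) * B * C + A * (B * B + 4) * C + A * B * (C * C + 4) ≡
                     A * B * C * (A + B + C) + 4 * (A * B + B * C + C * A)
  lemma₂ = solve-∀

∣l+v⇒∣e₂ : ∀ {d} A B C n → d % 2 ≡ 1 → d ∣ A * B * C →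
  d ∣ l (2 + A) (2 + B) (2 + C) n + v (2 + A) (2 + B) (2 + C) → d ∣ e₂ A B C
∣l+v⇒∣e₂ {d} A B C n odd d∣ABC d∣l+v =
  odd∣2*m⇒∣m _ odd (odd∣2*m⇒∣m _ odd (subst (d ∣_) (*-assoc 2 2 (e₂ A B C)) d∣4e₂))
  where
  d∣8ABCn+vnum : d ∣ 8 * (A * B * C) * n + vnum (2 + A) (2 + B) (2 + C)
  d∣8ABCn+vnum = subst (d ∣_) (2^δ*[l+v]≡8Pn+vnum (2 + A) (2 + B) (2 + C) n)
                               (∣n⇒∣m*n (2 ^ δ (2 + A) (2 + B) (2 + C)) d∣l+v)
  d∣vnum : d ∣ vnum (2 + A) (2 + B) (2 + C)
  d∣vnum = ∣m+n∣m⇒∣n d∣8ABCn+vnum (∣m⇒∣m*n n (∣n⇒∣m*n 8 d∣ABC))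
  d∣4e₂ : d ∣ 4 * e₂ A B C
  d∣4e₂ = ∣m+n∣m⇒∣n (subst (d ∣_) (vnum-identity A B C) (∣m∣n⇒∣m+n d∣vnum (∣n⇒∣m*n 12 d∣ABC)))
                    (∣m⇒∣m*n (A + B + C) d∣ABC)

lemma2p3 : (a b c : ℕ) → 3 ≤ a → 3 ≤ b → 3 ≤ c →
    (p : ℕ) → Prime p → p % 2 ≡ 1 →
    AnisotropicQp p (a ∸ 2) (b ∸ 2) (c ∸ 2) →
    ∃ λ C → ∀ (n : ℕ) → ¬ (p ^ (1 + C) ∣ (l a b c n + v a b c))
lemma2p3 (suc (suc A)) (suc (suc B)) (suc (suc C)) (s≤s (s≤s 0<A)) (s≤s (s≤s 0<B)) (s≤s (s≤s 0<C))
         p p-prime odd anisotropic =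
  e ∸ 1 , λ n p^[1+e∸1]∣ → anisotropic (isotropic-if-e₂-divisible p-prime odd vA vB vC
    (∣l+v⇒∣e₂ A B C n (^-odd e odd) (p^ord∣ p-prime (valuation-* p-prime (valuation-* p-prime vA vB) vC))
              (∣-trans (^-monoʳ-∣ p (m≤n+m∸n e 1)) p^[1+e∸1]∣)))
  where
  vA = valuation p-prime A {{>-nonZero 0<A}}
  vB = valuation p-prime B {{>-nonZero 0<B}}
  vC = valuation p-prime C {{>-nonZero 0<C}}
  e = ord vA + ord vB + ord vC
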